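{- Let $D$ be a non-empty set of non-empty, pairwise coherent paths based on a base of net $\beta$, such that the maximal elements of $D$ (for the prefix order) are positive, and let $D^*$ be its closure under non-empty prefixes. Then the set of chronicles $\ulcorner D^*\urcorner=\{\ulcorner q\urcorner: q\in D^*\}$ forms a net of designs based on $\beta$.
   Context: Ludics (Girard). Loci are finite sequences of naturals; $\xi.i$ extends $\xi$ by $i$. An action is a proper action $(\epsilon,\xi,I)$ (polarity $\epsilon\in\{+,-\}$, focus $\xi$, finite ramification $I$) or the positive daimon $\maltese$; $(\epsilon,\xi.i,J)$ is justified by $(\bar\epsilon,\xi,I)$ when $i\in I$. A chronicle is a non-empty finite alternating sequence of actions such that positive proper actions are justified by earlier actions or initial, negative actions are initial (and first) or justified by the immediately preceding positive action, proper actions have distinct focuses, and a daimon is last. A chronicle is based on $\Gamma\vdash\Delta$ if its initial negative focus (if any) is in $\Gamma$ and its initial positive focuses are in $\Delta$. Chronicles $c_1,c_2$ are coherent if (i) whenever $w\kappa_1,w\kappa_2$ are prefixes of $c_1,c_2$, $\kappa_1=\kappa_2$ or both are negative, and (ii) whenever $w(-,\xi_1,I_1)w_1\kappa_1$, $w(-,\xi_2,I_2)w_2\kappa_2$ are prefixes with $\xi_1\ne\xi_2$, $\kappa_1,\kappa_2$ have distinct focuses. A design based on $\Gamma\vdash\Delta$ ($\Delta$ finite set of loci, $\Gamma$ at most one locus, no locus a prefix of another) is a set of chronicles based on it, closed under non-empty prefixes, pairwise coherent, whose chronicles without extension end with a positive action, and which, if $\Gamma=\emptyset$, is non-empty with all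 chronicles beginning with the same positive action. A net of designs based on a base of net $\beta$ is a finite set of designs based on sequents of $\beta$, with disjoint bases. A base of net $\beta$ is a non-empty finite set of sequents $\Gamma_1\vdash\Delta_1,\dots,\Gamma_n\vdash\Delta_n$ of pairwise disjoint loci, each $\Gamma_i$ containing exactly one locus except at most one empty. An action is initial if its focus is in some $\Gamma_i\cup\Delta_i$. Views: $\ulcorner\epsilon\urcorner=\epsilon$, $\ulcorner w\kappa^+\urcorner=\ulcorner w\urcorner\kappa^+$, $\ulcorner w\kappa^-\urcorner=\ulcorner w_0\urcorner\kappa^-$, $w_0$ empty if $\kappa^-$ is initial, else the prefix of $w$ ending with the justifier of $\kappa^-$. A path based on $\beta$ is a finite sequence $p$ of actions, each a daimon or hereditarily justified from some $\Gamma_i\cup\Delta_i$, such that: polarities alternate; each proper action is justified by an earlier one or initial (negative: focus in some $\Gamma_i$; positive: in some $\Delta_i$); for every prefix $q\kappa$, a positive proper $\kappa$ justified by a negative $\kappa'$ has $\kappa'$ in $\ulcorner q\urcorner$, and an initial positive proper $\kappa$ with focus in $\Delta_i$ is either first with $\Gamma_i=\emptyset$ or immediately preceded by a negative action hereditarily justified from $\Gamma_i\cup\Delta_i$; proper actions have distinct focuses; a daimon is last, and if first some $\Gamma_i$ is empty; if some $\Gamma_i$ is empty, $p$ is non-empty and begins with $\maltese$ or a positive action on $\Delta_i$. A path is positive if its last action is positive. Two paths $p_1,p_2$ on the same base are coherent when: their first actions have the same polarity and are equal if positive; for all prefixes $w_1\kappa_1^+$, $w_2\kappa_2^+$ with $\ulcorner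 w_1\urcorner=\ulcorner w_2\urcorner$, $\kappa_1^+=\kappa_2^+$; and for all prefixes $w_1\kappa_1^-,w_2\kappa_2^-$, letting $w_j^0$ be empty if $\kappa_j^-$ is initial and otherwise the prefix of $p_j$ ending with the justifier of $\kappa_j^-$, if $\ulcorner w_1^0\urcorner=\ulcorner w_2^0\urcorner$ and $\kappa_1^-,\kappa_2^-$ have distinct focuses, then for all actions $\sigma_1,\sigma_2$ such that $w_j\kappa_j^-w_j'\sigma_j$ is a prefix of $p_j$ with $\kappa_j^-$ occurring in $\ulcorner w_j\kappa_j^-w_j'\sigma_j\urcorner$ ($j=1,2$), $\sigma_1$ and $\sigma_2$ have distinct focuses. -}

module Defs where

open import Data.Nat using (ℕ; zero; suc; _+_)
open import Data.Nat.Properties using () renaming (_≟_ to _≟ℕ_)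
open import Data.List using (List; []; _∷_; _++_; [_]; reverse; concatMap)
open import Data.Bool.ListAction using (any)
open import Data.List.Properties using (≡-dec)
open import Data.List.Membership.Propositional using (_∈_)
open import Data.List.Relation.Unary.Any using (Any)
open import Data.List.Relation.Unary.All using (All)
open import Data.List.Relation.Unary.AllPairs using (AllPairs)
open import Data.Maybe using (Maybe; just; nothing)
open import Data.Bool using (Bool; true; false; _∧_; if_then_else_; T)
open import Data.Product using (Σ; ∃; ∃₂; _×_; _,_; proj₁; proj₂)
open import Data.Sum using (_⊎_)
open import Data.Empty using (⊥)
open import Relation.Nullary using (¬_)
open import Relation.Nullary.Decidable using (⌊_⌋)
open import Relation.Binary.PropositionalEquality using (_≡_; _≢_)

Locus : Set
Locus = List ℕ           -- ξ.i is  ξ ++ [ i ]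

_≟L_ : (ξ ζ : Locus) → Relation.Nullary.Dec (ξ ≡ ζ)
_≟L_ = ≡-dec _≟ℕ_

open import Data.List.Membership.DecPropositional _≟L_ using () renaming (_∈?_ to _∈L?_)

_⊑_ : Locus → Locus → Set
ξ ⊑ ζ = ∃ λ w → ξ ++ w ≡ ζ

Disjoint : Locus → Locus → Set
Disjoint ξ ζ = ¬ (ξ ⊑ ζ) × ¬ (ζ ⊑ ξ)

-- Ramifications: finite subsets of ℕ, canonically encoded by gaps
-- [g₀, g₁, g₂, …] denotes {g₀, g₀+g₁+1, g₀+g₁+g₂+2, …}
-- (a bijection between List ℕ and finite subsets of ℕ, so that
-- equality of ramifications is propositional equality).

Ram : Set
Ram = List ℕ

elemsFrom : ℕ → Ram → List ℕ
elemsFrom b []       = []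
elemsFrom b (g ∷ gs) = (b + g) ∷ elemsFrom (suc (b + g)) gs

elems : Ram → List ℕ
elems = elemsFrom 0

_∈R_ : ℕ → Ram → Set
i ∈R I = i ∈ elems I

data Pol : Set where
  pos neg : Pol

data Action : Set where
  ✠   : Action
  act : Pol → Locus → Ram → Action

pol : Action → Pol
pol ✠           = pos
pol (act ε _ _) = ε

focus : Action → Maybe Locus
focus ✠           = nothing
focus (act _ ξ _) = just ξ

Positive Negative : Action → Set
Positive κ = pol κ ≡ pos
Negative κ = pol κ ≡ neg

opposite : Pol → Pol → Bool
opposite pos neg = true
opposite neg pos = true
opposite _   _   = false

justBy : Action → Action → Bool
justBy (act ε ζ J) (act ε' ξ I) =
  opposite ε ε' ∧ any (λ i → ⌊ ζ ≟L (ξ ++ [ i ]) ⌋) (elems I)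
justBy _ _ = false

JustifiedBy : Action → Action → Set
JustifiedBy κ κ' = T (justBy κ κ')

-- κ and κ' have distinct focuses (vacuous if one is a daimon)
DistinctFocus : Action → Action → Set
DistinctFocus κ κ' = ∀ ξ → focus κ ≡ just ξ → focus κ' ≡ just ξ → ⊥

IsPrefix : List Action → List Action → Set
IsPrefix p q = ∃ λ r → p ++ r ≡ q

StrictPrefix : List Action → List Action → Set
StrictPrefix p q = ∃ λ r → r ≢ [] × p ++ r ≡ q

record Seq : Set where
  constructor _⊢_
  field
    Γ : Maybe Locus
    Δ : List Locus
open Seq public

maybeList : Maybe Locus → List Locus
maybeList nothing  = []
maybeList (just ξ) = ξ ∷ []

locs : Seq → List Locus
locs s = maybeList (Γ s) ++ Δ s

DisjointSeqs : Seq → Seq → Set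
DisjointSeqs s t = ∀ ξ ζ → ξ ∈ locs s → ζ ∈ locs t → Disjoint ξ ζ

record Chronicle (c : List Action) : Set where
  field
    nonEmpty   : c ≢ []
    alternate  : ∀ w κ κ' v → c ≡ w ++ κ ∷ κ' ∷ v → pol κ ≢ pol κ'
    negJust    : ∀ w ξ I v → c ≡ w ++ act neg ξ I ∷ v →
                 w ≡ [] ⊎ ∃₂ λ w' κ' → w ≡ w' ++ [ κ' ] × JustifiedBy (act neg ξ I) κ'
    distinct   : ∀ w κ u κ' v → c ≡ w ++ κ ∷ u ++ κ' ∷ v → DistinctFocus κ κ'
    daimonLast : ∀ w v → c ≡ w ++ ✠ ∷ v → v ≡ []

record BasedOn (s : Seq) (c : List Action) : Set where
  field
    firstNeg   : ∀ ξ I v → c ≡ act neg ξ I ∷ v → Γ s ≡ just ξ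
    posInitial : ∀ w ξ I v → c ≡ w ++ act pos ξ I ∷ v →
                 Any (JustifiedBy (act pos ξ I)) w ⊎ ξ ∈ Δ s

record ChronCoherent (c₁ c₂ : List Action) : Set where
  field
    coh-i  : ∀ w κ₁ κ₂ → IsPrefix (w ++ [ κ₁ ]) c₁ → IsPrefix (w ++ [ κ₂ ]) c₂ →
             κ₁ ≡ κ₂ ⊎ (Negative κ₁ × Negative κ₂)
    coh-ii : ∀ w ξ₁ I₁ w₁ κ₁ ξ₂ I₂ w₂ κ₂ →
             IsPrefix (w ++ act neg ξ₁ I₁ ∷ w₁ ++ [ κ₁ ]) c₁ →
             IsPrefix (w ++ act neg ξ₂ I₂ ∷ w₂ ++ [ κ₂ ]) c₂ →
             ξ₁ ≢ ξ₂ → DistinctFocus κ₁ κ₂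

ChronSet : Set₁
ChronSet = List Action → Set

record IsDesign (s : Seq) (X : ChronSet) : Set where
  field
    baseOK       : AllPairs Disjoint (locs s)
    chronicles   : ∀ c → X c → Chronicle c × BasedOn s c
    prefixClosed : ∀ c p → X c → p ≢ [] → IsPrefix p c → X p
    coherent     : ∀ c₁ c₂ → X c₁ → X c₂ → c₁ ≢ c₂ → ChronCoherent c₁ c₂
    maximalPos   : ∀ c → X c → (∀ c' → X c' → ¬ StrictPrefix c c') →
                   ∃₂ λ w κ → c ≡ w ++ [ κ ] × Positive κ
    emptyΓ       : Γ s ≡ nothing →
                   (∃ λ c → X c) ×
                   (∃ λ κ → Positive κ × ∀ c → X c → ∃ λ v → c ≡ κ ∷ v)

allLoci : List Seq → List Locus
allLoci = concatMap locs

record IsBaseOfNet (β : List Seq) : Set where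
  field
    nonEmpty       : β ≢ []
    disjointLoci   : AllPairs Disjoint (allLoci β)
    atMostOneEmpty : AllPairs (λ s t → ¬ (Γ s ≡ nothing × Γ t ≡ nothing)) β

record NetOfDesigns (β : List Seq) (S : ChronSet) : Set₁ where
  field
    designs       : List (Seq × ChronSet)
    based         : All (λ d → proj₁ d ∈ β × IsDesign (proj₁ d) (proj₂ d)) designs
    disjointBases : AllPairs (λ d e → DisjointSeqs (proj₁ d) (proj₁ e)) designs
    union→        : ∀ c → S c → Any (λ d → proj₂ d c) designs
    union←        : ∀ c → Any (λ d → proj₂ d c) designs → S c

module _ (β : List Seq) where

  initialᵇ : Action → Bool
  initialᵇ ✠           = false
  initialᵇ (act _ ξ _) = ⌊ ξ ∈L? allLoci β ⌋

  -- views computed on reversed sequences (last action first)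
  mutual
    viewR : List Action → List Action
    viewR []                 = []
    viewR (✠ ∷ rw)           = ✠ ∷ viewR rw
    viewR (act pos ξ I ∷ rw) = act pos ξ I ∷ viewR rw
    viewR (act neg ξ I ∷ rw) =
      if initialᵇ (act neg ξ I) then act neg ξ I ∷ [] else act neg ξ I ∷ seek (act neg ξ I) rw

    seek : Action → List Action → List Action
    seek κ []        = []
    seek κ (κ' ∷ rw) = if justBy κ κ' then viewR (κ' ∷ rw) else seek κ rw

  view : List Action → List Action
  view w = reverse (viewR (reverse w))

  w⁰R : Action → List Action → List Action
  w⁰R κ []        = []
  w⁰R κ (κ' ∷ rw) = if justBy κ κ' then κ' ∷ rw else w⁰R κ rw

  -- w⁰ for an action κ following w: empty if κ is initial, otherwise
  -- the prefix of w ending with the justifier of κ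
  justPrefix : List Action → Action → List Action
  justPrefix w κ = if initialᵇ κ then [] else reverse (w⁰R κ (reverse w))

-- Hereditary justification:  HJ L w κ  — the action κ, occurring right
-- after w, is hereditarily justified (through actions of w) from L.

data HJ (L : List Locus) : List Action → Action → Set where
  initial   : ∀ {w κ ξ} → focus κ ≡ just ξ → ξ ∈ L → HJ L w κ
  justified : ∀ {w₁ κ' w₂ κ} → JustifiedBy κ κ' → HJ L w₁ κ' → HJ L (w₁ ++ κ' ∷ w₂) κ

InitialFocus : List Seq → Pol → Locus → Set
InitialFocus β neg ξ = Any (λ s → Γ s ≡ just ξ) β
InitialFocus β pos ξ = Any (λ s → ξ ∈ Δ s) β

record Path (β : List Seq) (p : List Action) : Set where
  field
    hereditary : ∀ w κ v → p ≡ w ++ κ ∷ v → κ ≡ ✠ ⊎ Any (λ s → HJ (locs s) w κ) β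
    alternate  : ∀ w κ κ' v → p ≡ w ++ κ ∷ κ' ∷ v → pol κ ≢ pol κ'
    justOrInit : ∀ w ε ξ I v → p ≡ w ++ act ε ξ I ∷ v →
                 Any (JustifiedBy (act ε ξ I)) w ⊎ InitialFocus β ε ξ
    viewCond   : ∀ q ξ I v κ' → p ≡ q ++ act pos ξ I ∷ v → κ' ∈ q → Negative κ' →
                 JustifiedBy (act pos ξ I) κ' → κ' ∈ view β q
    initPos    : ∀ q ξ I v s → p ≡ q ++ act pos ξ I ∷ v → s ∈ β → ξ ∈ Δ s →
                 (q ≡ [] × Γ s ≡ nothing) ⊎
                 (∃₂ λ q' κ' → q ≡ q' ++ [ κ' ] × Negative κ' × HJ (locs s) q' κ')
    distinct   : ∀ w κ u κ' v → p ≡ w ++ κ ∷ u ++ κ' ∷ v → DistinctFocus κ κ'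
    daimonLast : ∀ w v → p ≡ w ++ ✠ ∷ v → v ≡ []
    daimonFirst : ∀ v → p ≡ ✠ ∷ v → Any (λ s → Γ s ≡ nothing) β
    emptyΓ     : ∀ s → s ∈ β → Γ s ≡ nothing →
                 ∃₂ λ κ v → p ≡ κ ∷ v × (κ ≡ ✠ ⊎ ∃₂ λ ξ I → κ ≡ act pos ξ I × ξ ∈ Δ s)

PositivePath : List Action → Set
PositivePath p = ∃₂ λ w κ → p ≡ w ++ [ κ ] × Positive κ

record CoherentPaths (β : List Seq) (p₁ p₂ : List Action) : Set where
  field
    first  : ∀ κ₁ v₁ κ₂ v₂ → p₁ ≡ κ₁ ∷ v₁ → p₂ ≡ κ₂ ∷ v₂ →
             pol κ₁ ≡ pol κ₂ × (Positive κ₁ → κ₁ ≡ κ₂)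
    posCoh : ∀ w₁ κ₁ v₁ w₂ κ₂ v₂ → p₁ ≡ w₁ ++ κ₁ ∷ v₁ → p₂ ≡ w₂ ++ κ₂ ∷ v₂ →
             Positive κ₁ → Positive κ₂ → view β w₁ ≡ view β w₂ → κ₁ ≡ κ₂
    negCoh : ∀ w₁ κ₁ w₁' σ₁ v₁ w₂ κ₂ w₂' σ₂ v₂ →
             p₁ ≡ w₁ ++ κ₁ ∷ w₁' ++ σ₁ ∷ v₁ → p₂ ≡ w₂ ++ κ₂ ∷ w₂' ++ σ₂ ∷ v₂ →
             Negative κ₁ → Negative κ₂ →
             view β (justPrefix β w₁ κ₁) ≡ view β (justPrefix β w₂ κ₂) →
             DistinctFocus κ₁ κ₂ →
             κ₁ ∈ view β (w₁ ++ κ₁ ∷ w₁' ++ [ σ₁ ]) →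
             κ₂ ∈ view β (w₂ ++ κ₂ ∷ w₂' ++ [ σ₂ ]) →
             DistinctFocus σ₁ σ₂

PrefixClosure : ChronSet → ChronSet
PrefixClosure D q = q ≢ [] × ∃ λ p → D p × IsPrefix q p

ViewSet : List Seq → ChronSet → ChronSet
ViewSet β X c = ∃ λ q → X q × view β q ≡ c

-- The chronicles of ⌜D*⌝ are the views ⌜ q ⌝ of non-empty prefixes q of paths p ∈ D. Every action of
-- ⌜ q ⌝ occurs in q, and inside ⌜ q ⌝ it is preceded by its predecessor in q when it is positive and by
-- its justifier when it is negative; so the chronicle conditions on ⌜ q ⌝ are inherited from p, and
-- following justifiers back to the first action puts every focus of ⌜ q ⌝ above a locus of the sequent
-- of β on which ⌜ q ⌝ starts. Grouping the views by that sequent gives one design per sequent of β.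
-- Coherence of two views is the coherence of their paths or, when both come from the same path, the
-- fact that a position in a path is determined by its view. A view ending negatively extends by the
-- next, necessarily positive, action of its path, or else ends a path that is maximal in D and hence
-- positive; so maximal chronicles are positive.

module Submission where

open import Defs
open import Data.Nat using (zero; suc; _≤_; z≤n; s≤s; s≤s⁻¹)
open import Data.Nat.Properties using (≤-trans; ≤-refl) renaming (_≟_ to _≟ℕ_)
open import Data.List using (List; []; _∷_; _++_; [_]; _∷ʳ_; reverse; length; map; initLast; _∷ʳ′_)
open import Data.List.Properties
  using (++-assoc; ++-identityʳ; ++-cancelˡ; ∷-injective; ∷-injectiveˡ; ∷ʳ-injective; ∷ʳ-injectiveˡ;
         ∷ʳ-injectiveʳ; reverse-++; reverse-involutive; unfold-reverse; length-++-≤ˡ; ≡-dec)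
open import Data.List.Membership.Propositional using (_∈_; find; lose)
open import Data.List.Membership.Propositional.Properties using (∈-∃++; ∈-++⁺ˡ; ∈-++⁺ʳ)
open import Data.List.Membership.DecPropositional _≟L_ using () renaming (_∈?_ to _∈L?_)
open import Data.List.Relation.Unary.Any using (Any; here; there; satisfied)
open import Data.List.Relation.Unary.Any.Properties using (any⁻; reverse⁺; map⁺; map⁻)
open import Data.List.Relation.Unary.All using (All; []; _∷_; tabulate)
import Data.List.Relation.Unary.All as All
import Data.List.Relation.Unary.All.Properties as All
open import Data.List.Relation.Unary.AllPairs using (AllPairs; []; _∷_)
import Data.List.Relation.Unary.AllPairs.Properties as AllPairs
open import Data.Maybe using (just; nothing)
open import Data.Maybe.Properties using (just-injective)
open import Data.Bool using (true; false; T; if_then_else_)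
open import Data.Product using (∃; ∃₂; _×_; _,_; proj₁; proj₂)
open import Data.Sum using (_⊎_; inj₁; inj₂)
open import Data.Empty using (⊥; ⊥-elim)
open import Relation.Nullary using (¬_; Dec; yes; no)
open import Relation.Nullary.Decidable using (toWitness)
open import Relation.Binary.PropositionalEquality using (_≡_; _≢_; refl; sym; trans; cong; subst)

module _ {A : Set} where

  ∷ʳ-≢-[] : ∀ (w : List A) x → w ∷ʳ x ≢ []
  ∷ʳ-≢-[] []      x ()
  ∷ʳ-≢-[] (_ ∷ _) x ()

  ++-∷-≢-[] : ∀ (u : List A) x v → u ++ x ∷ v ≢ []
  ++-∷-≢-[] []      x v ()
  ++-∷-≢-[] (_ ∷ _) x v ()

  length-<-++-∷ : ∀ (u : List A) x v → suc (length u) ≤ length (u ++ x ∷ v)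
  length-<-++-∷ []      x v = s≤s z≤n
  length-<-++-∷ (_ ∷ u) x v = s≤s (length-<-++-∷ u x v)

  length-++-∷-≤⁻ : ∀ {n} (u : List A) x v → length (u ++ x ∷ v) ≤ suc n → length u ≤ n
  length-++-∷-≤⁻ u x v l = s≤s⁻¹ (≤-trans (length-<-++-∷ u x v) l)

  ++-∷-trichotomy : ∀ (a a' : List A) {y y' r r'} → a ++ y ∷ r ≡ a' ++ y' ∷ r' →
                    (a ≡ a' × y ≡ y' × r ≡ r') ⊎
                    ((∃ λ m → a' ≡ a ++ y ∷ m × r ≡ m ++ y' ∷ r') ⊎
                     (∃ λ m → a ≡ a' ++ y' ∷ m × r' ≡ m ++ y ∷ r))
  ++-∷-trichotomy []      []       refl = inj₁ (refl , refl , refl)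
  ++-∷-trichotomy []      (x ∷ a') refl = inj₂ (inj₁ (a' , refl , refl))
  ++-∷-trichotomy (x ∷ a) []       refl = inj₂ (inj₂ (a , refl , refl))
  ++-∷-trichotomy (x ∷ a) (_ ∷ a') eq with ∷-injective eq
  ... | refl , eq' with ++-∷-trichotomy a a' eq'
  ... | inj₁ (e₁ , e₂ , e₃)          = inj₁ (cong (x ∷_) e₁ , e₂ , e₃)
  ... | inj₂ (inj₁ (m , e₁ , e₂)) = inj₂ (inj₁ (m , cong (x ∷_) e₁ , e₂))
  ... | inj₂ (inj₂ (m , e₁ , e₂)) = inj₂ (inj₂ (m , cong (x ∷_) e₁ , e₂))

  ++-∷-≡-∷ʳ : ∀ (u : List A) x v w y → u ++ x ∷ v ≡ w ∷ʳ y →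
              (v ≡ [] × u ≡ w × x ≡ y) ⊎ (∃ λ v' → v ≡ v' ∷ʳ y × u ++ x ∷ v' ≡ w)
  ++-∷-≡-∷ʳ u x v w y eq with initLast v
  ... | [] with ∷ʳ-injective u w eq
  ...   | e₁ , e₂ = inj₁ (refl , e₁ , e₂)
  ++-∷-≡-∷ʳ u x v w y eq | v' ∷ʳ′ z
    with ∷ʳ-injective (u ++ x ∷ v') w (trans (++-assoc u (x ∷ v') [ z ]) eq)
  ... | e , refl = inj₂ (v' , refl , e)

  occurrence-++ : ∀ {q p : List A} u x v r → q ≡ u ++ x ∷ v → q ++ r ≡ p → p ≡ u ++ x ∷ (v ++ r)
  occurrence-++ u x v r refl refl = ++-assoc u (x ∷ v) r

  prefix-∷ʳ : ∀ (w : List A) x {t} → (∃ λ r → (w ∷ʳ x) ++ r ≡ t) → ∃ λ t' → t ≡ w ++ x ∷ t'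
  prefix-∷ʳ w x (t' , e) = t' , trans (sym e) (++-assoc w [ x ] t')

  ++-∷-++-∷ʳ-assoc : ∀ (w : List A) x u y t → (w ++ x ∷ u ++ [ y ]) ++ t ≡ w ++ x ∷ u ++ y ∷ t
  ++-∷-++-∷ʳ-assoc w x u y t = trans (++-assoc w (x ∷ u ++ [ y ]) t) (cong (λ z → w ++ x ∷ z) (++-assoc u [ y ] t))

  allPairs-++⁻ : ∀ {R : A → A → Set} xs {ys} → AllPairs R (xs ++ ys) →
                 AllPairs R xs × AllPairs R ys × All (λ x → All (R x) ys) xs
  allPairs-++⁻ []       Rys       = [] , Rys , []
  allPairs-++⁻ (x ∷ xs) (h ∷ Rxys) with allPairs-++⁻ xs Rxys
  ... | Rxs , Rys , Rxsys = All.++⁻ˡ xs h ∷ Rxs , Rys , All.++⁻ʳ xs h ∷ Rxsys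

_≟ᴾ_ : (ε ε' : Pol) → Dec (ε ≡ ε')
pos ≟ᴾ pos = yes refl
pos ≟ᴾ neg = no λ ()
neg ≟ᴾ pos = no λ ()
neg ≟ᴾ neg = yes refl

_≟ᴬ_ : (κ κ' : Action) → Dec (κ ≡ κ')
✠         ≟ᴬ ✠           = yes refl
✠         ≟ᴬ act _ _ _   = no λ ()
act _ _ _ ≟ᴬ ✠           = no λ ()
act ε ξ I ≟ᴬ act ε' ξ' I' with ε ≟ᴾ ε' | ξ ≟L ξ' | ≡-dec _≟ℕ_ I I'
... | yes refl | yes refl | yes refl = yes refl
... | no ne    | _        | _        = no λ { refl → ne refl }
... | yes _    | no ne    | _        = no λ { refl → ne refl }
... | yes _    | yes _    | no ne    = no λ { refl → ne refl }

_≟ᴸ_ : (w w' : List Action) → Dec (w ≡ w')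
_≟ᴸ_ = ≡-dec _≟ᴬ_

neg≢pos : neg ≢ pos
neg≢pos ()

pol≢pos⇒neg : ∀ κ → pol κ ≢ pos → Negative κ
pol≢pos⇒neg κ ne with pol κ
... | pos = ⊥-elim (ne refl)
... | neg = refl

pol≢neg⇒pos : ∀ κ → pol κ ≢ neg → Positive κ
pol≢neg⇒pos κ ne with pol κ
... | pos = refl
... | neg = ⊥-elim (ne refl)

≢-both⇒≡ : ∀ {ε₁ ε₂ ε : Pol} → ε₁ ≢ ε → ε₂ ≢ ε → ε₁ ≡ ε₂
≢-both⇒≡ {pos} {pos} _ _ = refl
≢-both⇒≡ {neg} {neg} _ _ = refl
≢-both⇒≡ {pos} {neg} {pos} ne _ = ⊥-elim (ne refl)
≢-both⇒≡ {pos} {neg} {neg} _ ne = ⊥-elim (ne refl)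
≢-both⇒≡ {neg} {pos} {pos} _ ne = ⊥-elim (ne refl)
≢-both⇒≡ {neg} {pos} {neg} ne _ = ⊥-elim (ne refl)

negative-focus : ∀ κ → Negative κ → ∃ λ ζ → focus κ ≡ just ζ
negative-focus (act neg ζ _) refl = ζ , refl

Chronicle-same-pol : ∀ {c₁ c₂} → Chronicle c₁ → Chronicle c₂ → ∀ w z κ₁ κ₂ t₁ t₂ →
                     c₁ ≡ (w ∷ʳ z) ++ κ₁ ∷ t₁ → c₂ ≡ (w ∷ʳ z) ++ κ₂ ∷ t₂ → pol κ₁ ≡ pol κ₂
Chronicle-same-pol ch₁ ch₂ w z κ₁ κ₂ t₁ t₂ e₁ e₂ =
  ≢-both⇒≡ (λ eq → Chronicle.alternate ch₁ w z κ₁ t₁ (trans e₁ (++-assoc w [ z ] (κ₁ ∷ t₁))) (sym eq))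
           (λ eq → Chronicle.alternate ch₂ w z κ₂ t₂ (trans e₂ (++-assoc w [ z ] (κ₂ ∷ t₂))) (sym eq))

justifiedBy-focus : ∀ κ κ' → JustifiedBy κ κ' →
                    ∃₂ λ ζ ξ → focus κ ≡ just ζ × focus κ' ≡ just ξ × ∃ λ i → ζ ≡ ξ ++ [ i ]
justifiedBy-focus (act pos ζ J) (act neg ξ I) t with find (any⁻ _ (elems I) t)
... | i , _ , w = ζ , ξ , refl , refl , i , toWitness w
justifiedBy-focus (act neg ζ J) (act pos ξ I) t with find (any⁻ _ (elems I) t)
... | i , _ , w = ζ , ξ , refl , refl , i , toWitness w

justifiedBy-pol : ∀ κ κ' → JustifiedBy κ κ' → pol κ ≢ pol κ'
justifiedBy-pol (act pos ζ J) (act neg ξ I) t ()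
justifiedBy-pol (act neg ζ J) (act pos ξ I) t ()

justifier-of-positive : ∀ ξ I κ' → JustifiedBy (act pos ξ I) κ' → Negative κ'
justifier-of-positive ξ I (act neg _ _) t = refl

⊑-refl : ∀ ξ → ξ ⊑ ξ
⊑-refl ξ = [] , ++-identityʳ ξ

⊑-trans : ∀ {ξ ζ η} → ξ ⊑ ζ → ζ ⊑ η → ξ ⊑ η
⊑-trans {ξ} (u , refl) (v , refl) = u ++ v , sym (++-assoc ξ u v)

⊑-child : ∀ ξ i → ξ ⊑ (ξ ++ [ i ])
⊑-child ξ i = [ i ] , refl

child⋢parent : ∀ ξ i → ¬ (ξ ++ [ i ]) ⊑ ξ
child⋢parent []      i (r , ())
child⋢parent (x ∷ ξ) i (r , e) = child⋢parent ξ i (r , proj₂ (∷-injective e))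

⊑-total-below : ∀ (ξ ζ : Locus) {η u v} → ξ ++ u ≡ η → ζ ++ v ≡ η → ξ ⊑ ζ ⊎ ζ ⊑ ξ
⊑-total-below []      ζ       _ _ = inj₁ (ζ , refl)
⊑-total-below (x ∷ ξ) []      _ _ = inj₂ (x ∷ ξ , refl)
⊑-total-below (x ∷ ξ) (_ ∷ ζ) e₁ e₂ with ∷-injective (trans e₁ (sym e₂))
... | refl , e with ⊑-total-below ξ ζ e refl
...   | inj₁ (r , q) = inj₁ (r , cong (x ∷_) q)
...   | inj₂ (r , q) = inj₂ (r , cong (x ∷_) q)

⊑-common⇒¬Disjoint : ∀ {ξ ζ η} → ξ ⊑ η → ζ ⊑ η → ¬ Disjoint ξ ζ
⊑-common⇒¬Disjoint {ξ} {ζ} (_ , e₁) (_ , e₂) (ξ⋢ζ , ζ⋢ξ) with ⊑-total-below ξ ζ e₁ e₂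
... | inj₁ ξ⊑ζ = ξ⋢ζ ξ⊑ζ
... | inj₂ ζ⊑ξ = ζ⋢ξ ζ⊑ξ

¬Disjoint-self : ∀ ξ → ¬ Disjoint ξ ξ
¬Disjoint-self ξ (ξ⋢ξ , _) = ξ⋢ξ (⊑-refl ξ)

Disjoint-sym : ∀ {ξ ζ} → Disjoint ξ ζ → Disjoint ζ ξ
Disjoint-sym (d₁ , d₂) = d₂ , d₁

AllPairs-Disjoint-unique : ∀ {L ξ ζ} → AllPairs Disjoint L → ξ ∈ L → ζ ∈ L → ¬ Disjoint ξ ζ → ξ ≡ ζ
AllPairs-Disjoint-unique (_ ∷ _)  (here refl) (here refl) nd = refl
AllPairs-Disjoint-unique (h ∷ _)  (here refl) (there ζ∈)  nd = ⊥-elim (nd (All.lookup h ζ∈))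
AllPairs-Disjoint-unique (h ∷ _)  (there ξ∈)  (here refl) nd = ⊥-elim (nd (Disjoint-sym (All.lookup h ξ∈)))
AllPairs-Disjoint-unique (_ ∷ ds) (there ξ∈)  (there ζ∈)  nd = AllPairs-Disjoint-unique ds ξ∈ ζ∈ nd

Γ∈locs : ∀ {s ξ} → Γ s ≡ just ξ → ξ ∈ locs s
Γ∈locs {_ ⊢ _} refl = here refl

Δ∈locs : ∀ {s ξ} → ξ ∈ Δ s → ξ ∈ locs s
Δ∈locs {s} = ∈-++⁺ʳ (maybeList (Γ s))

∈-allLoci⁺ : ∀ {β s ξ} → s ∈ β → ξ ∈ locs s → ξ ∈ allLoci β
∈-allLoci⁺ {s ∷ β} (here refl) m = ∈-++⁺ˡ m
∈-allLoci⁺ {t ∷ β} (there s∈)  m = ∈-++⁺ʳ (locs t) (∈-allLoci⁺ s∈ m)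

module _ {β : List Seq} (disj : AllPairs Disjoint (allLoci β)) where

  sequent-unique : ∀ {s s' ξ ξ'} → s ∈ β → s' ∈ β → ξ ∈ locs s → ξ' ∈ locs s' →
                   ¬ Disjoint ξ ξ' → s ≡ s'
  sequent-unique {s} {s'} s∈ s'∈ m m' nd = go disj s∈ s'∈
    where
    go : ∀ {β} → AllPairs Disjoint (allLoci β) → s ∈ β → s' ∈ β → s ≡ s'
    go {t ∷ _} ds s∈ s'∈ with allPairs-++⁻ (locs t) ds | s∈ | s'∈
    ... | _ , _   , _      | here refl | here refl  = refl
    ... | _ , _   , across | here refl | there s'∈ =
      ⊥-elim (nd (All.lookup (All.lookup across m) (∈-allLoci⁺ s'∈ m')))
    ... | _ , _   , across | there s∈  | here refl =
      ⊥-elim (nd (Disjoint-sym (All.lookup (All.lookup across m') (∈-allLoci⁺ s∈ m))))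
    ... | _ , ds' , _      | there s∈  | there s'∈ = go ds' s∈ s'∈

locs-disjoint : ∀ {β s} → AllPairs Disjoint (allLoci β) → s ∈ β → AllPairs Disjoint (locs s)
locs-disjoint {t ∷ _} ds s∈ with allPairs-++⁻ (locs t) ds | s∈
... | dst , _   , _ | here refl = dst
... | _   , ds' , _ | there s∈  = locs-disjoint ds' s∈

sequents-disjoint : ∀ {β} → AllPairs Disjoint (allLoci β) → AllPairs DisjointSeqs β
sequents-disjoint {[]}    ds = []
sequents-disjoint {t ∷ β} ds with allPairs-++⁻ (locs t) ds
... | _ , ds' , across =
  tabulate (λ s∈ ξ ζ m m' → All.lookup (All.lookup across m) (∈-allLoci⁺ s∈ m')) ∷ sequents-disjoint ds'

HJ-first : ∀ {L w κ} → HJ L w κ → w ≡ [] → ∃ λ ξ → focus κ ≡ just ξ × ξ ∈ L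
HJ-first (initial {ξ = ξ} fκ m) _ = ξ , fκ , m
HJ-first (justified {w₁ = w₁} {κ' = κ'} {w₂ = w₂} _ _) e = ⊥-elim (++-∷-≢-[] w₁ κ' w₂ e)

RootedIn : List Locus → Action → Set
RootedIn L κ = ∀ {ζ} → focus κ ≡ just ζ → ∃ λ l → l ∈ L × l ⊑ ζ

RootedIn-justified : ∀ {L κ κ'} → JustifiedBy κ κ' → RootedIn L κ' → RootedIn L κ
RootedIn-justified {κ = κ} {κ'} t ρ fκ with justifiedBy-focus κ κ' t
... | _ , ξ , fκ₀ , fκ' , i , refl with just-injective (trans (sym fκ₀) fκ) | ρ fκ'
...   | refl | l , l∈ , l⊑ = l , l∈ , ⊑-trans l⊑ (⊑-child ξ i)

HJ-rootedIn : ∀ {L w κ} → HJ L w κ → RootedIn L κ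
HJ-rootedIn (initial fκ' m) fκ with just-injective (trans (sym fκ') fκ)
... | refl = _ , m , ⊑-refl _
HJ-rootedIn (justified t h) = RootedIn-justified t (HJ-rootedIn h)

data Opens (s : Seq) : Action → Set where
  proper : ∀ {ε ξ I} → ξ ∈ locs s → Opens s (act ε ξ I)
  daimon : Γ s ≡ nothing → Opens s ✠

StartsIn : Seq → List Action → Set
StartsIn s c = ∃₂ λ κ v → c ≡ κ ∷ v × Opens s κ

StartsIn-first : ∀ {s c κ v} → StartsIn s c → c ≡ κ ∷ v → Opens s κ
StartsIn-first (_ , _ , refl , o) refl = o

Opens-rootedIn : ∀ {s κ} → Opens s κ → RootedIn (locs s) κ
Opens-rootedIn (proper m) refl = _ , m , ⊑-refl _

StartsIn-prefix : ∀ {s c c'} → StartsIn s c → c' ≢ [] → IsPrefix c' c → StartsIn s c'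
StartsIn-prefix {c' = []}    _                  c'≢[] _       = ⊥-elim (c'≢[] refl)
StartsIn-prefix {c' = κ ∷ v} (_ , _ , refl , o) _     (_ , e) with ∷-injective e
... | refl , _ = κ , v , refl , o

StartsIn-++ : ∀ {s c} x → StartsIn s c → StartsIn s (c ++ x)
StartsIn-++ x (κ , v , refl , o) = κ , v ++ x , refl , o

empty-Γ-opening : ∀ {s κ} → Γ s ≡ nothing → (κ ≡ ✠ ⊎ ∃₂ λ ξ I → κ ≡ act pos ξ I × ξ ∈ Δ s) →
                  Positive κ × Opens s κ
empty-Γ-opening     Γ≡ (inj₁ refl)                = refl , daimon Γ≡
empty-Γ-opening {s} Γ≡ (inj₂ (ξ , I , refl , ξ∈)) = refl , proper (Δ∈locs {s} ξ∈)

module Views (β : List Seq) where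

  ⌜_⌝ : List Action → List Action
  ⌜ w ⌝ = view β w

  view-reverse : ∀ rw → ⌜ reverse rw ⌝ ≡ reverse (viewR β rw)
  view-reverse rw = cong (λ z → reverse (viewR β z)) (reverse-involutive rw)

  view-∷ʳ-pos : ∀ w κ → Positive κ → ⌜ w ∷ʳ κ ⌝ ≡ ⌜ w ⌝ ∷ʳ κ
  view-∷ʳ-pos w κ pκ = trans (cong (λ z → reverse (viewR β z)) (reverse-++ w [ κ ])) (last κ pκ)
    where
    last : ∀ κ → Positive κ → reverse (viewR β (κ ∷ reverse w)) ≡ ⌜ w ⌝ ∷ʳ κ
    last ✠             _ = unfold-reverse ✠ (viewR β (reverse w))
    last (act pos ξ I) _ = unfold-reverse (act pos ξ I) (viewR β (reverse w))

  seek≡viewR-w⁰R : ∀ κ rw → seek β κ rw ≡ viewR β (w⁰R β κ rw)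
  seek≡viewR-w⁰R κ []        = refl
  seek≡viewR-w⁰R κ (κ' ∷ rw) with justBy κ κ'
  ... | true  = refl
  ... | false = seek≡viewR-w⁰R κ rw

  view-∷ʳ-neg : ∀ w ξ I → ⌜ w ∷ʳ act neg ξ I ⌝ ≡ ⌜ justPrefix β w (act neg ξ I) ⌝ ∷ʳ act neg ξ I
  view-∷ʳ-neg w ξ I =
    trans (cong (λ z → reverse (viewR β z)) (reverse-++ w [ κ ])) (byInitial (reverse w))
    where
    κ : Action
    κ = act neg ξ I
    byInitial : ∀ rw → reverse (viewR β (κ ∷ rw)) ≡
                ⌜ (if initialᵇ β κ then [] else reverse (w⁰R β κ rw)) ⌝ ∷ʳ κ
    byInitial rw with initialᵇ β κ
    ... | true  = refl
    ... | false = trans (unfold-reverse κ (seek β κ rw))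
                    (cong (_∷ʳ κ) (trans (cong reverse (seek≡viewR-w⁰R κ rw)) (sym (view-reverse (w⁰R β κ rw)))))

  view-∷ʳ-pos⁻ : ∀ w κ u → Positive κ → ⌜ w ∷ʳ κ ⌝ ≡ u ∷ʳ κ → ⌜ w ⌝ ≡ u
  view-∷ʳ-pos⁻ w κ u pκ e = ∷ʳ-injectiveˡ ⌜ w ⌝ u (trans (sym (view-∷ʳ-pos w κ pκ)) e)

  view-∷ʳ-neg⁻ : ∀ w ξ I u → ⌜ w ∷ʳ act neg ξ I ⌝ ≡ u ∷ʳ act neg ξ I → ⌜ justPrefix β w (act neg ξ I) ⌝ ≡ u
  view-∷ʳ-neg⁻ w ξ I u e = ∷ʳ-injectiveˡ _ u (trans (sym (view-∷ʳ-neg w ξ I)) e)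

  w⁰R-suffix : ∀ κ rw → ∃ λ t → t ++ w⁰R β κ rw ≡ rw
  w⁰R-suffix κ []        = [] , refl
  w⁰R-suffix κ (κ' ∷ rw) with justBy κ κ'
  ... | true  = [] , refl
  ... | false with w⁰R-suffix κ rw
  ...   | t , e = κ' ∷ t , cong (κ' ∷_) e

  w⁰R-starts-with-justifier :
    ∀ κ rw → w⁰R β κ rw ≡ [] ⊎ ∃₂ λ κ' rw' → w⁰R β κ rw ≡ κ' ∷ rw' × JustifiedBy κ κ'
  w⁰R-starts-with-justifier κ []        = inj₁ refl
  w⁰R-starts-with-justifier κ (κ' ∷ rw) with justBy κ κ' in eq
  ... | true  = inj₂ (κ' , rw , refl , subst T (sym eq) _)
  ... | false = w⁰R-starts-with-justifier κ rw

  w⁰R-≢-[] : ∀ κ rw → Any (JustifiedBy κ) rw → w⁰R β κ rw ≢ []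
  w⁰R-≢-[] κ (κ' ∷ rw) a with justBy κ κ' in eq
  ... | true = λ ()
  w⁰R-≢-[] κ (κ' ∷ rw) (here t)  | false = ⊥-elim (subst T eq t)
  w⁰R-≢-[] κ (κ' ∷ rw) (there a) | false = w⁰R-≢-[] κ rw a

  justPrefix-prefix : ∀ w κ → IsPrefix (justPrefix β w κ) w
  justPrefix-prefix w κ with initialᵇ β κ
  ... | true  = w , refl
  ... | false with w⁰R-suffix κ (reverse w)
  ...   | t , e = reverse t , trans (sym (reverse-++ t (w⁰R β κ (reverse w))))
                                    (trans (cong reverse e) (reverse-involutive w))

  justPrefix-ends-with-justifier :
    ∀ w κ → justPrefix β w κ ≡ [] ⊎ ∃₂ λ w' κ' → justPrefix β w κ ≡ w' ∷ʳ κ' × JustifiedBy κ κ'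
  justPrefix-ends-with-justifier w κ with initialᵇ β κ
  ... | true  = inj₁ refl
  ... | false with w⁰R-starts-with-justifier κ (reverse w)
  ...   | inj₁ e = inj₁ (cong reverse e)
  ...   | inj₂ (κ' , rw' , e , t) = inj₂ (reverse rw' , κ' , trans (cong reverse e) (unfold-reverse κ' rw') , t)

  justPrefix-≢-[] : ∀ w κ → initialᵇ β κ ≡ false → Any (JustifiedBy κ) w → justPrefix β w κ ≢ []
  justPrefix-≢-[] w κ ¬init a e rewrite ¬init =
    w⁰R-≢-[] κ (reverse w) (reverse⁺ a) (trans (sym (reverse-involutive _)) (cong reverse e))

  initial⇒∈allLoci : ∀ ε ξ I → initialᵇ β (act ε ξ I) ≡ true → ξ ∈ allLoci β
  initial⇒∈allLoci ε ξ I eq with ξ ∈L? allLoci β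
  ... | yes m = m
  ... | no _  with () ← eq

  view-∷ʳ : ∀ w κ → ∃ λ w' → IsPrefix w' w × ⌜ w ∷ʳ κ ⌝ ≡ ⌜ w' ⌝ ∷ʳ κ
  view-∷ʳ w ✠             = w , ([] , ++-identityʳ w) , view-∷ʳ-pos w ✠ refl
  view-∷ʳ w (act pos ξ I) = w , ([] , ++-identityʳ w) , view-∷ʳ-pos w (act pos ξ I) refl
  view-∷ʳ w (act neg ξ I) = justPrefix β w (act neg ξ I) , justPrefix-prefix w _ , view-∷ʳ-neg w ξ I

  view-≡-[] : ∀ q → ⌜ q ⌝ ≡ [] → q ≡ []
  view-≡-[] q e with initLast q
  ... | []      = refl
  ... | w ∷ʳ′ y with view-∷ʳ w y
  ...   | w' , _ , e' = ⊥-elim (∷ʳ-≢-[] ⌜ w' ⌝ y (trans (sym e') e))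

  view-≡-∷ʳ : ∀ q w κ → ⌜ q ⌝ ≡ w ∷ʳ κ → ∃ λ q' → q ≡ q' ∷ʳ κ
  view-≡-∷ʳ q w κ e with initLast q
  ... | []      = ⊥-elim (∷ʳ-≢-[] w κ (sym e))
  ... | q' ∷ʳ′ y with view-∷ʳ q' y
  ...   | q'' , _ , e' with ∷ʳ-injectiveʳ ⌜ q'' ⌝ w (trans (sym e') e)
  ...     | refl = q' , refl

  view-occurrence : ∀ q u κ v → ⌜ q ⌝ ≡ u ++ κ ∷ v →
                    ∃₂ λ q₁ q₂ → q ≡ q₁ ++ κ ∷ q₂ × ⌜ q₁ ∷ʳ κ ⌝ ≡ u ∷ʳ κ
  view-occurrence q = bounded (length q) q ≤-refl
    where
    bounded : ∀ n q → length q ≤ n → ∀ u κ v → ⌜ q ⌝ ≡ u ++ κ ∷ v →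
              ∃₂ λ q₁ q₂ → q ≡ q₁ ++ κ ∷ q₂ × ⌜ q₁ ∷ʳ κ ⌝ ≡ u ∷ʳ κ
    bounded n q l u κ v e with initLast q
    ... | [] = ⊥-elim (++-∷-≢-[] u κ v (sym e))
    ... | w ∷ʳ′ y with view-∷ʳ w y
    ...   | w' , (t , refl) , e' with ++-∷-≡-∷ʳ u κ v ⌜ w' ⌝ y (trans (sym e) e')
    ...     | inj₁ (refl , refl , refl) = w' ++ t , [] , refl , e'
    bounded zero    _ l u κ v e | w ∷ʳ′ y | w' , (t , refl) , e' | inj₂ _
      with () ← ≤-trans (length-<-++-∷ (w' ++ t) y []) l
    bounded (suc n) _ l u κ v e | w ∷ʳ′ y | w' , (t , refl) , e' | inj₂ (v' , refl , e₂)
      with bounded n w' (≤-trans (length-++-≤ˡ w') (length-++-∷-≤⁻ (w' ++ t) y [] l)) u κ v' (sym e₂)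
    ... | q₁ , q₂ , refl , e₃ = q₁ , q₂ ++ (t ∷ʳ y) , reassoc , e₃
      where
      reassoc : ((q₁ ++ κ ∷ q₂) ++ t) ∷ʳ y ≡ q₁ ++ κ ∷ (q₂ ++ (t ∷ʳ y))
      reassoc = trans (++-assoc (q₁ ++ κ ∷ q₂) t [ y ]) (++-assoc q₁ (κ ∷ q₂) (t ∷ʳ y))

  view-occurrence₂ : ∀ q w κ u κ' v → ⌜ q ⌝ ≡ w ++ κ ∷ u ++ κ' ∷ v →
                     ∃₂ λ a b → ∃ λ c → q ≡ a ++ κ ∷ b ++ κ' ∷ c × ⌜ a ∷ʳ κ ⌝ ≡ w ∷ʳ κ ×
                                        ⌜ (a ++ κ ∷ b) ∷ʳ κ' ⌝ ≡ (w ++ κ ∷ u) ∷ʳ κ'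
  view-occurrence₂ q w κ u κ' v e
    with view-occurrence q (w ++ κ ∷ u) κ' v (trans e (sym (++-assoc w (κ ∷ u) (κ' ∷ v))))
  ... | q₁ , q₂ , refl , e₂ with view-∷ʳ q₁ κ'
  ...   | w'' , (t , refl) , e₃
    with view-occurrence w'' w κ u (∷ʳ-injectiveˡ ⌜ w'' ⌝ (w ++ κ ∷ u) (trans (sym e₃) e₂))
  ...     | a , b , refl , e₅ =
    a , b ++ t , q₂ , trans (cong (_++ κ' ∷ q₂) assoc) (++-assoc a (κ ∷ b ++ t) (κ' ∷ q₂)) , e₅ ,
    trans (cong (λ z → ⌜ z ∷ʳ κ' ⌝) (sym assoc)) e₂
    where
    assoc : (a ++ κ ∷ b) ++ t ≡ a ++ κ ∷ b ++ t
    assoc = ++-assoc a (κ ∷ b) t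

  view-∷ʳ-last : ∀ w y u z → ⌜ w ∷ʳ y ⌝ ≡ u ∷ʳ z → y ≡ z
  view-∷ʳ-last w y u z e with view-∷ʳ w y
  ... | w' , _ , e' = ∷ʳ-injectiveʳ ⌜ w' ⌝ u (trans (sym e') e)

  view-predecessor : ∀ q₁ κ' w κ → ⌜ q₁ ∷ʳ κ' ⌝ ≡ (w ∷ʳ κ) ∷ʳ κ' →
                     (Positive κ' × ∃ λ q₁' → q₁ ≡ q₁' ∷ʳ κ) ⊎ (Negative κ' × JustifiedBy κ' κ)
  view-predecessor q₁ ✠             w κ e =
    inj₁ (refl , view-≡-∷ʳ q₁ w κ (view-∷ʳ-pos⁻ q₁ ✠ (w ∷ʳ κ) refl e))
  view-predecessor q₁ (act pos ξ I) w κ e =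
    inj₁ (refl , view-≡-∷ʳ q₁ w κ (view-∷ʳ-pos⁻ q₁ (act pos ξ I) (w ∷ʳ κ) refl e))
  view-predecessor q₁ (act neg ξ I) w κ e
    with justPrefix-ends-with-justifier q₁ (act neg ξ I)
       | view-∷ʳ-neg⁻ q₁ ξ I (w ∷ʳ κ) e
  ... | inj₁ jp≡[]              | e' = ⊥-elim (∷ʳ-≢-[] w κ (trans (sym e') (cong ⌜_⌝ jp≡[])))
  ... | inj₂ (w' , κ'' , jp≡ , t) | e' with view-∷ʳ-last w' κ'' w κ (trans (cong ⌜_⌝ (sym jp≡)) e')
  ...   | refl = inj₂ (refl , t)

module OnBase (β : List Seq) (bn : IsBaseOfNet β) where
  open Views β public

  disj : AllPairs Disjoint (allLoci β)
  disj = IsBaseOfNet.disjointLoci bn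

  RootedIn-sequent-unique : ∀ {s s' κ ζ} → s ∈ β → s' ∈ β → focus κ ≡ just ζ →
                            RootedIn (locs s) κ → RootedIn (locs s') κ → s ≡ s'
  RootedIn-sequent-unique s∈ s'∈ fκ ρ ρ' with ρ fκ | ρ' fκ
  ... | l , l∈ , l⊑ | l' , l'∈ , l'⊑ = sequent-unique disj s∈ s'∈ l∈ l'∈ (⊑-common⇒¬Disjoint l⊑ l'⊑)

  module _ {p : List Action} (P : Path β p) where

    path-focus-position-unique : ∀ {a a' y y' r r' ζ} → p ≡ a ++ y ∷ r → p ≡ a' ++ y' ∷ r' →
                                 focus y ≡ just ζ → focus y' ≡ just ζ → a ≡ a' × y ≡ y'
    path-focus-position-unique {a} {a'} {y} {y'} {r} {r'} {ζ} e₁ e₂ f f'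
      with ++-∷-trichotomy a a' (trans (sym e₁) e₂)
    ... | inj₁ (ea , ey , _)            = ea , ey
    ... | inj₂ (inj₁ (m , refl , refl)) = ⊥-elim (Path.distinct P a y m y' r' e₁ ζ f f')
    ... | inj₂ (inj₂ (m , refl , refl)) = ⊥-elim (Path.distinct P a' y' m y r e₂ ζ f' f)

    path-position-unique : ∀ {a a' y r r'} → p ≡ a ++ y ∷ r → p ≡ a' ++ y ∷ r' → a ≡ a'
    path-position-unique {y = act _ _ _} e₁ e₂ = proj₁ (path-focus-position-unique e₁ e₂ refl refl)
    path-position-unique {a} {a'} {✠} {r} {r'} e₁ e₂
      with Path.daimonLast P a r e₁ | Path.daimonLast P a' r' e₂
    ... | refl | refl = ∷ʳ-injectiveˡ a a' (trans (sym e₁) e₂)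

    path-focus-rooted : ∀ {w κ v ξ} → p ≡ w ++ κ ∷ v → focus κ ≡ just ξ → ∃ λ l → l ∈ allLoci β × l ⊑ ξ
    path-focus-rooted {w} {κ} {v} e fκ with Path.hereditary P w κ v e
    ... | inj₁ refl with () ← fκ
    ... | inj₂ hj with find hj
    ...   | s , s∈ , h with HJ-rootedIn h fκ
    ...     | l , l∈ , l⊑ = l , ∈-allLoci⁺ s∈ l∈ , l⊑

    path-justified-not-initial : ∀ {w κ v ζ} → p ≡ w ++ κ ∷ v → focus κ ≡ just ζ →
                                 Any (JustifiedBy κ) w → ¬ ζ ∈ allLoci β
    path-justified-not-initial {w} {κ} {v} {ζ} e fκ a ζ∈ with find a
    ... | κ' , κ'∈ , t with ∈-∃++ κ'∈ | justifiedBy-focus κ κ' t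
    ...   | w₁ , w₂ , refl | _ , ξ , fκ₀ , fκ' , i , refl with just-injective (trans (sym fκ₀) fκ)
    ...     | refl with path-focus-rooted (trans e (++-assoc w₁ (κ' ∷ w₂) (κ ∷ v))) fκ'
    ...       | l , l∈ , l⊑ with AllPairs-Disjoint-unique disj l∈ ζ∈
                                   (⊑-common⇒¬Disjoint (⊑-trans l⊑ (⊑-child ξ i)) (⊑-refl ζ))
    ...         | refl = child⋢parent ξ i l⊑

    path-first-opens : ∀ {κ v} → p ≡ κ ∷ v → ∃ λ s → s ∈ β × Opens s κ
    path-first-opens {✠} {v} e with find (Path.daimonFirst P v e)
    ... | s , s∈ , Γ≡ = s , s∈ , daimon Γ≡
    path-first-opens {act ε ξ I} {v} e with Path.hereditary P [] (act ε ξ I) v e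
    ... | inj₂ hj with find hj
    ...   | s , s∈ , h with HJ-first h refl
    ...     | _ , refl , m = s , s∈ , proper m

    path-view-injective : ∀ {a₁ a₂ κ₁ κ₂ v₁ v₂} → p ≡ a₁ ++ κ₁ ∷ v₁ → p ≡ a₂ ++ κ₂ ∷ v₂ →
                          ⌜ a₁ ⌝ ≡ ⌜ a₂ ⌝ → a₁ ≡ a₂
    path-view-injective {a₁} {a₂} {κ₁} {κ₂} {v₁} {v₂} e₁ e₂ ev with initLast a₁
    ... | [] = sym (view-≡-[] a₂ (sym ev))
    ... | a₁' ∷ʳ′ y with view-∷ʳ a₁' y
    ...   | a₁'' , _ , e₃ with view-≡-∷ʳ a₂ ⌜ a₁'' ⌝ y (trans (sym ev) e₃)
    ...     | a₂' , refl with path-position-unique (trans e₁ (++-assoc a₁' [ y ] (κ₁ ∷ v₁)))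
                                                  (trans e₂ (++-assoc a₂' [ y ] (κ₂ ∷ v₂)))
    ...       | refl = refl

  module PathPrefix {p : List Action} (P : Path β p) (q r : List Action) (pr : q ++ r ≡ p) where

    in-path : ∀ {u κ v} → q ≡ u ++ κ ∷ v → p ≡ u ++ κ ∷ (v ++ r)
    in-path {u} {κ} {v} e = occurrence-++ u κ v r e pr

    view-alternate : ∀ w κ κ' v → ⌜ q ⌝ ≡ w ++ κ ∷ κ' ∷ v → pol κ ≢ pol κ'
    view-alternate w κ κ' v e with view-occurrence q (w ∷ʳ κ) κ' v (trans e (sym (++-assoc w [ κ ] (κ' ∷ v))))
    ... | q₁ , q₂ , refl , e' with view-predecessor q₁ κ' w κ e'
    ...   | inj₁ (_ , q₁' , refl) =
            Path.alternate P q₁' κ κ' (q₂ ++ r) (trans (in-path refl) (++-assoc q₁' [ κ ] (κ' ∷ q₂ ++ r)))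
    ...   | inj₂ (_ , t) = λ pe → justifiedBy-pol κ' κ t (sym pe)

    view-negJust : ∀ w ξ I v → ⌜ q ⌝ ≡ w ++ act neg ξ I ∷ v →
                   w ≡ [] ⊎ ∃₂ λ w' κ' → w ≡ w' ++ [ κ' ] × JustifiedBy (act neg ξ I) κ'
    view-negJust w ξ I v e with initLast w
    ... | [] = inj₁ refl
    ... | w' ∷ʳ′ κ' with view-occurrence q (w' ∷ʳ κ') (act neg ξ I) v e
    ...   | q₁ , q₂ , refl , e' with view-predecessor q₁ (act neg ξ I) w' κ' e'
    ...     | inj₂ (_ , t) = inj₂ (w' , κ' , refl , t)

    view-occurrence₂-in-path : ∀ w κ u κ' v → ⌜ q ⌝ ≡ w ++ κ ∷ u ++ κ' ∷ v →
                               ∃₂ λ a b → ∃ λ c → p ≡ a ++ κ ∷ b ++ κ' ∷ c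
    view-occurrence₂-in-path w κ u κ' v e with view-occurrence₂ q w κ u κ' v e
    ... | a , b , c , refl , _ , _ =
      a , b , c ++ r , trans (in-path refl) (cong (λ z → a ++ κ ∷ z) (++-assoc b (κ' ∷ c) r))

    view-distinct : ∀ w κ u κ' v → ⌜ q ⌝ ≡ w ++ κ ∷ u ++ κ' ∷ v → DistinctFocus κ κ'
    view-distinct w κ u κ' v e with view-occurrence₂-in-path w κ u κ' v e
    ... | a , b , c , e' = Path.distinct P a κ b κ' c e'

    view-daimonLast : ∀ w v → ⌜ q ⌝ ≡ w ++ ✠ ∷ v → v ≡ []
    view-daimonLast w v e with initLast v
    ... | [] = refl
    ... | v' ∷ʳ′ z with view-occurrence₂-in-path w ✠ v' z [] e
    ...   | a , b , c , e' = ⊥-elim (++-∷-≢-[] b z c (Path.daimonLast P a (b ++ z ∷ c) e'))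

    view-chronicle : q ≢ [] → Chronicle ⌜ q ⌝
    view-chronicle q≢[] = record
      { nonEmpty   = λ e → q≢[] (view-≡-[] q e)
      ; alternate  = view-alternate
      ; negJust    = view-negJust
      ; distinct   = view-distinct
      ; daimonLast = view-daimonLast
      }

    view-first-positive : ∀ κ v → ⌜ q ⌝ ≡ κ ∷ v → Positive κ → ∃ λ v' → p ≡ κ ∷ v'
    view-first-positive κ v e pκ with view-occurrence q [] κ v e
    ... | q₁ , q₂ , refl , e' with view-≡-[] q₁ (view-∷ʳ-pos⁻ q₁ κ [] pκ e')
    ...   | refl = q₂ ++ r , in-path {[]} refl

    view-first-negative : ∀ ξ I v → ⌜ q ⌝ ≡ act neg ξ I ∷ v → InitialFocus β neg ξ
    view-first-negative ξ I v e with view-occurrence q [] (act neg ξ I) v e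
    ... | q₁ , q₂ , refl , e' with Path.justOrInit P q₁ neg ξ I (q₂ ++ r) (in-path refl)
    ...   | inj₂ init = init
    ...   | inj₁ a with initialᵇ β (act neg ξ I) in ini
    ...     | true  = ⊥-elim (path-justified-not-initial P (in-path refl) refl a (initial⇒∈allLoci neg ξ I ini))
    ...     | false = ⊥-elim (justPrefix-≢-[] q₁ (act neg ξ I) ini a
                        (view-≡-[] _ (view-∷ʳ-neg⁻ q₁ ξ I [] e')))

    view-positive-origin : ∀ u ξ I v → ⌜ q ⌝ ≡ u ++ act pos ξ I ∷ v →
      Any (JustifiedBy (act pos ξ I)) u ⊎
      (∃ λ s → s ∈ β × ξ ∈ Δ s ×
         ((u ≡ [] × Γ s ≡ nothing) ⊎ ∃₂ λ u' κ' → u ≡ u' ∷ʳ κ' × Negative κ' × RootedIn (locs s) κ'))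
    view-positive-origin u ξ I v e with view-occurrence q u (act pos ξ I) v e
    ... | q₁ , q₂ , refl , e' with view-∷ʳ-pos⁻ q₁ (act pos ξ I) u refl e'
    ...   | refl with Path.justOrInit P q₁ pos ξ I (q₂ ++ r) (in-path refl)
    ...     | inj₁ a with find a
    ...       | κ' , κ'∈ , t =
                inj₁ (lose (Path.viewCond P q₁ ξ I (q₂ ++ r) κ' (in-path refl) κ'∈
                                          (justifier-of-positive ξ I κ' t) t) t)
    view-positive-origin u ξ I v e | q₁ , q₂ , refl , e' | refl | inj₂ inΔ with find inΔ
    ... | s , s∈ , ξ∈ with Path.initPos P q₁ ξ I (q₂ ++ r) s (in-path refl) s∈ ξ∈
    ...   | inj₁ (refl , Γ≡) = inj₂ (s , s∈ , ξ∈ , inj₁ (refl , Γ≡))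
    ...   | inj₂ (q₁' , κ' , refl , κ'⁻ , hj) with view-∷ʳ q₁' κ'
    ...     | w , _ , e'' = inj₂ (s , s∈ , ξ∈ , inj₂ (⌜ w ⌝ , κ' , e'' , κ'⁻ , HJ-rootedIn hj))

    view-positive-occurrence : ∀ w κ t → ⌜ q ⌝ ≡ w ++ κ ∷ t → Positive κ →
                               ∃₂ λ a b → p ≡ a ++ κ ∷ b × ⌜ a ⌝ ≡ w
    view-positive-occurrence w κ t e pκ with view-occurrence q w κ t e
    ... | a , b , refl , e' = a , b ++ r , in-path refl , view-∷ʳ-pos⁻ a κ w pκ e'

    view-negative-segment : ∀ w ξ I u κ t → ⌜ q ⌝ ≡ w ++ act neg ξ I ∷ u ++ κ ∷ t →
      ∃₂ λ a b → ∃ λ d → p ≡ a ++ act neg ξ I ∷ b ++ κ ∷ d ×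
        ⌜ justPrefix β a (act neg ξ I) ⌝ ≡ w × ⌜ (a ++ act neg ξ I ∷ b) ∷ʳ κ ⌝ ≡ (w ++ act neg ξ I ∷ u) ∷ʳ κ
    view-negative-segment w ξ I u κ t e with view-occurrence₂ q w (act neg ξ I) u κ t e
    ... | a , b , d , refl , ea , eb =
      a , b , d ++ r , trans (in-path refl) (cong (λ z → a ++ act neg ξ I ∷ z) (++-assoc b (κ ∷ d) r)) ,
      view-∷ʳ-neg⁻ a ξ I w ea , eb

    module _ {s : Seq} (s∈ : s ∈ β) (start : StartsIn s ⌜ q ⌝) where

      view-rootedIn : ∀ u κ v → ⌜ q ⌝ ≡ u ++ κ ∷ v → RootedIn (locs s) κ
      view-rootedIn u = bounded (length u) u ≤-refl
        where
        bounded : ∀ n u → length u ≤ n → ∀ κ v → ⌜ q ⌝ ≡ u ++ κ ∷ v → RootedIn (locs s) κ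
        earlier : ∀ {n} u κ' u' {κ v} → length (u ++ κ' ∷ u') ≤ n →
                  ⌜ q ⌝ ≡ (u ++ κ' ∷ u') ++ κ ∷ v → RootedIn (locs s) κ'

        earlier {zero}  u κ' u' l _ with () ← ≤-trans (length-<-++-∷ u κ' u') l
        earlier {suc n} u κ' u' {κ} {v} l e =
          bounded n u (length-++-∷-≤⁻ u κ' u' l) κ' (u' ++ κ ∷ v) (trans e (++-assoc u (κ' ∷ u') (κ ∷ v)))

        bounded _ _ _ ✠ _ _ = λ ()
        bounded n u l (act neg ξ I) v e with view-negJust u ξ I v e
        ... | inj₁ refl                  = Opens-rootedIn (StartsIn-first start e)
        ... | inj₂ (u' , κ' , refl , t) = RootedIn-justified t (earlier u' κ' [] l e)
        bounded n u l (act pos ξ I) v e with view-positive-origin u ξ I v e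
        ... | inj₁ a with find a
        ...   | κ' , κ'∈ , t with ∈-∃++ κ'∈
        ...     | u₁ , u₂ , refl = RootedIn-justified t (earlier u₁ κ' u₂ l e)
        bounded n u l (act pos ξ I) v e | inj₂ (_ , _ , _ , inj₁ (refl , _)) = Opens-rootedIn (StartsIn-first start e)
        bounded n u l (act pos ξ I) v e | inj₂ (s' , s'∈ , ξ∈ , inj₂ (u' , κ' , refl , κ'⁻ , ρ'))
          with negative-focus κ' κ'⁻
        ... | _ , fκ' with RootedIn-sequent-unique s∈ s'∈ fκ' (earlier u' κ' [] l e) ρ'
        ...   | refl = λ { refl → ξ , Δ∈locs {s} ξ∈ , ⊑-refl ξ }

      view-first-positive-Γ : ∀ κ v → ⌜ q ⌝ ≡ κ ∷ v → Positive κ → Γ s ≡ nothing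
      -- a positive first action of p is initial, and `initPos` then forces Γ s to be empty
      view-first-positive-Γ κ v e pκ with view-first-positive κ v e pκ | StartsIn-first start e
      ... | _ , ep | daimon Γ≡ = Γ≡
      ... | v' , ep | proper {pos} {ξ} {I} m with Path.justOrInit P [] pos ξ I v' ep
      ...   | inj₂ inΔ with find inΔ
      ...     | s' , s'∈ , ξ∈ with sequent-unique disj s∈ s'∈ m (Δ∈locs {s'} ξ∈) (¬Disjoint-self ξ)
      ...       | refl with Path.initPos P [] ξ I v' s ep s∈ ξ∈
      ...         | inj₁ (_ , Γ≡)          = Γ≡
      ...         | inj₂ (q' , _ , e₀ , _) = ⊥-elim (∷ʳ-≢-[] q' _ (sym e₀))

      view-basedOn : BasedOn s ⌜ q ⌝
      view-basedOn = record { firstNeg = firstNeg ; posInitial = posInitial }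
        where
        firstNeg : ∀ ξ I v → ⌜ q ⌝ ≡ act neg ξ I ∷ v → Γ s ≡ just ξ
        firstNeg ξ I v e with find (view-first-negative ξ I v e) | StartsIn-first start e
        ... | s' , s'∈ , Γ≡ | proper m
          with sequent-unique disj s∈ s'∈ m (Γ∈locs {s'} Γ≡) (¬Disjoint-self ξ)
        ...   | refl = Γ≡

        posInitial : ∀ w ξ I v → ⌜ q ⌝ ≡ w ++ act pos ξ I ∷ v → Any (JustifiedBy (act pos ξ I)) w ⊎ ξ ∈ Δ s
        posInitial w ξ I v e with view-positive-origin w ξ I v e
        ... | inj₁ a = inj₁ a
        ... | inj₂ (s' , s'∈ , ξ∈ , _) with view-rootedIn w (act pos ξ I) v e refl
        ...   | l , l∈ , l⊑
          with sequent-unique disj s∈ s'∈ l∈ (Δ∈locs {s'} ξ∈) (⊑-common⇒¬Disjoint l⊑ (⊑-refl ξ))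
        ...     | refl = inj₂ ξ∈

    view-startsIn-some : q ≢ [] → ∃ λ s → s ∈ β × StartsIn s ⌜ q ⌝
    view-startsIn-some q≢[] with ⌜ q ⌝ in eq
    ... | [] = ⊥-elim (q≢[] (view-≡-[] q eq))
    ... | ✠ ∷ v with path-first-opens P (proj₂ (view-first-positive ✠ v eq refl))
    ...   | s , s∈ , o = s , s∈ , ✠ , v , refl , o
    view-startsIn-some q≢[] | act pos ξ I ∷ v
      with path-first-opens P (proj₂ (view-first-positive (act pos ξ I) v eq refl))
    ...   | s , s∈ , o = s , s∈ , act pos ξ I , v , refl , o
    view-startsIn-some q≢[] | act neg ξ I ∷ v with find (view-first-negative ξ I v eq)
    ...   | s , s∈ , Γ≡ = s , s∈ , act neg ξ I , v , refl , proper (Γ∈locs {s} Γ≡)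

module Construction (β : List Seq) (bn : IsBaseOfNet β) (D : List Action → Set)
  (D≢∅ : ∃ λ p → D p)
  (paths : ∀ p → D p → p ≢ [] × Path β p)
  (coh : ∀ p q → D p → D q → p ≢ q → CoherentPaths β p q)
  (maxp : ∀ p → D p → (∀ q → D q → ¬ StrictPrefix p q) → PositivePath p) where

  open OnBase β bn

  D* : ChronSet
  D* = PrefixClosure D

  p₀ : List Action
  p₀ = proj₁ D≢∅

  D₀ : D p₀
  D₀ = proj₂ D≢∅

  path : ∀ {p} → D p → Path β p
  path {p} Dp = proj₂ (paths p Dp)

  Design : Seq → ChronSet
  Design s c = ViewSet β D* c × StartsIn s c

  ⌜D*⌝-prefix-closed : ∀ c c' → ViewSet β D* c → c' ≢ [] → IsPrefix c' c → ViewSet β D* c'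
  ⌜D*⌝-prefix-closed c c' (q , (_ , p , Dp , (r , pr)) , refl) c'≢[] (t , e) with initLast c'
  ... | [] = ⊥-elim (c'≢[] refl)
  ... | u ∷ʳ′ κ with view-occurrence q u κ t (trans (sym e) (++-assoc u [ κ ] t))
  ...   | q₁ , q₂ , refl , e' =
    q₁ ∷ʳ κ , (∷ʳ-≢-[] q₁ κ , p , Dp , (q₂ ++ r , prefix)) , e'
    where
    prefix : (q₁ ∷ʳ κ) ++ q₂ ++ r ≡ p
    prefix = trans (++-assoc q₁ [ κ ] (q₂ ++ r)) (sym (occurrence-++ q₁ κ q₂ r refl pr))

  ⌜D*⌝-positive-coherent : ∀ {c₁ c₂} → ViewSet β D* c₁ → ViewSet β D* c₂ →
                           ∀ w κ₁ κ₂ t₁ t₂ → c₁ ≡ w ++ κ₁ ∷ t₁ → c₂ ≡ w ++ κ₂ ∷ t₂ →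
                           Positive κ₁ → Positive κ₂ → κ₁ ≡ κ₂
  ⌜D*⌝-positive-coherent (q₁ , (_ , p₁ , D₁ , (r₁ , pr₁)) , refl) (q₂ , (_ , p₂ , D₂ , (r₂ , pr₂)) , refl)
                         w κ₁ κ₂ t₁ t₂ e₁ e₂ pκ₁ pκ₂
    with PathPrefix.view-positive-occurrence (path D₁) q₁ r₁ pr₁ w κ₁ t₁ e₁ pκ₁
       | PathPrefix.view-positive-occurrence (path D₂) q₂ r₂ pr₂ w κ₂ t₂ e₂ pκ₂
  ... | a₁ , b₁ , ep₁ , ea₁ | a₂ , b₂ , ep₂ , ea₂ with p₁ ≟ᴸ p₂
  ...   | no p₁≢p₂ =
    CoherentPaths.posCoh (coh p₁ p₂ D₁ D₂ p₁≢p₂) a₁ κ₁ b₁ a₂ κ₂ b₂ ep₁ ep₂ pκ₁ pκ₂ (trans ea₁ (sym ea₂))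
  ...   | yes refl with path-view-injective (path D₁) ep₁ ep₂ (trans ea₁ (sym ea₂))
  ...     | refl = ∷-injectiveˡ (++-cancelˡ a₁ _ _ (trans (sym ep₁) ep₂))

  Design-chronicle : ∀ {s} → s ∈ β → ∀ c → Design s c → Chronicle c × BasedOn s c
  Design-chronicle s∈ c ((q , (q≢[] , p , Dp , (r , pr)) , refl) , start) =
    PathPrefix.view-chronicle (path Dp) q r pr q≢[] , PathPrefix.view-basedOn (path Dp) q r pr s∈ start

  Design-first : ∀ {s κ v} → s ∈ β → Design s (κ ∷ v) →
                 (Positive κ × Γ s ≡ nothing) ⊎ (Negative κ × ∃ λ ξ → Γ s ≡ just ξ)
  Design-first {s} {κ} {v} s∈ ((q , (_ , p , Dp , (r , pr)) , e) , start) = by-pol κ e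
    where
    open PathPrefix (path Dp) q r pr
    start' : StartsIn s ⌜ q ⌝
    start' = subst (StartsIn s) (sym e) start
    by-pol : ∀ κ → ⌜ q ⌝ ≡ κ ∷ v → (Positive κ × Γ s ≡ nothing) ⊎ (Negative κ × ∃ λ ξ → Γ s ≡ just ξ)
    by-pol ✠             e = inj₁ (refl , view-first-positive-Γ s∈ start' ✠ v e refl)
    by-pol (act pos ξ I) e = inj₁ (refl , view-first-positive-Γ s∈ start' (act pos ξ I) v e refl)
    by-pol (act neg ξ I) e = inj₂ (refl , ξ , BasedOn.firstNeg (view-basedOn s∈ start') ξ I v e)

  Design-same-pol : ∀ {s c₁ c₂} → s ∈ β → Design s c₁ → Design s c₂ →
                    ∀ w κ₁ κ₂ t₁ t₂ → c₁ ≡ w ++ κ₁ ∷ t₁ → c₂ ≡ w ++ κ₂ ∷ t₂ → pol κ₁ ≡ pol κ₂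
  Design-same-pol s∈ X₁ X₂ w κ₁ κ₂ t₁ t₂ e₁ e₂ with initLast w
  ... | w' ∷ʳ′ z = Chronicle-same-pol (proj₁ (Design-chronicle s∈ _ X₁)) (proj₁ (Design-chronicle s∈ _ X₂))
                                      w' z κ₁ κ₂ t₁ t₂ e₁ e₂
  Design-same-pol s∈ X₁ X₂ _ κ₁ κ₂ t₁ t₂ refl refl | []
    with Design-first s∈ X₁ | Design-first s∈ X₂
  ... | inj₁ (pκ₁ , _)      | inj₁ (pκ₂ , _)       = trans pκ₁ (sym pκ₂)
  ... | inj₂ (nκ₁ , _)      | inj₂ (nκ₂ , _)       = trans nκ₁ (sym nκ₂)
  ... | inj₁ (_ , Γ≡)       | inj₂ (_ , _ , Γ≡')   with () ← trans (sym Γ≡) Γ≡'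
  ... | inj₂ (_ , _ , Γ≡')  | inj₁ (_ , Γ≡)        with () ← trans (sym Γ≡) Γ≡'

  ⌜D*⌝-negative-coherent : ∀ {c₁ c₂} → ViewSet β D* c₁ → ViewSet β D* c₂ →
    ∀ w ξ₁ I₁ w₁ κ₁ ξ₂ I₂ w₂ κ₂ →
    IsPrefix (w ++ act neg ξ₁ I₁ ∷ w₁ ++ [ κ₁ ]) c₁ → IsPrefix (w ++ act neg ξ₂ I₂ ∷ w₂ ++ [ κ₂ ]) c₂ →
    ξ₁ ≢ ξ₂ → DistinctFocus κ₁ κ₂
  ⌜D*⌝-negative-coherent (q₁ , (_ , p₁ , D₁ , (r₁ , pr₁)) , refl) (q₂ , (_ , p₂ , D₂ , (r₂ , pr₂)) , refl)
                         w ξ₁ I₁ w₁ κ₁ ξ₂ I₂ w₂ κ₂ (t₁ , e₁) (t₂ , e₂) ξ₁≢ξ₂ ζ fκ₁ fκ₂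
    with PathPrefix.view-negative-segment (path D₁) q₁ r₁ pr₁ w ξ₁ I₁ w₁ κ₁ t₁
           (trans (sym e₁) (++-∷-++-∷ʳ-assoc w _ w₁ κ₁ t₁))
       | PathPrefix.view-negative-segment (path D₂) q₂ r₂ pr₂ w ξ₂ I₂ w₂ κ₂ t₂
           (trans (sym e₂) (++-∷-++-∷ʳ-assoc w _ w₂ κ₂ t₂))
  ... | a₁ , b₁ , d₁ , ep₁ , ej₁ , eb₁ | a₂ , b₂ , d₂ , ep₂ , ej₂ , eb₂ with p₁ ≟ᴸ p₂
  ...   | no p₁≢p₂ =
    CoherentPaths.negCoh (coh p₁ p₂ D₁ D₂ p₁≢p₂) a₁ (act neg ξ₁ I₁) b₁ κ₁ d₁ a₂ (act neg ξ₂ I₂) b₂ κ₂ d₂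
      ep₁ ep₂ refl refl (trans ej₁ (sym ej₂)) (λ _ → λ { refl refl → ξ₁≢ξ₂ refl })
      (∈-view a₁ b₁ eb₁) (∈-view a₂ b₂ eb₂) ζ fκ₁ fκ₂
    where
    ∈-view : ∀ {n u κ} a b → ⌜ (a ++ n ∷ b) ∷ʳ κ ⌝ ≡ (w ++ n ∷ u) ∷ʳ κ → n ∈ ⌜ a ++ n ∷ b ++ [ κ ] ⌝
    ∈-view {n} {u} {κ} a b eb =
      subst (λ z → n ∈ ⌜ z ⌝) (++-assoc a (n ∷ b) [ κ ]) (subst (n ∈_) (sym eb) (∈-++⁺ˡ (∈-++⁺ʳ w (here refl))))
  -- in a single path, κ₁ and κ₂ share a focus only as the same occurrence; then the views before
  -- them, hence ξ₁ and ξ₂, coincide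
  ...   | yes refl with path-focus-position-unique (path D₁)
                          (trans ep₁ (sym (++-assoc a₁ (act neg ξ₁ I₁ ∷ b₁) (κ₁ ∷ d₁))))
                          (trans ep₂ (sym (++-assoc a₂ (act neg ξ₂ I₂ ∷ b₂) (κ₂ ∷ d₂)))) fκ₁ fκ₂
  ...     | same-prefix , refl
    with ∷-injectiveˡ (++-cancelˡ w _ _ (∷ʳ-injectiveˡ _ _
           (trans (sym eb₁) (trans (cong (λ z → ⌜ z ∷ʳ κ₁ ⌝) same-prefix) eb₂))))
  ...       | refl = ξ₁≢ξ₂ refl

  Design-coherent : ∀ {s} → s ∈ β → ∀ c₁ c₂ → Design s c₁ → Design s c₂ → c₁ ≢ c₂ → ChronCoherent c₁ c₂
  Design-coherent s∈ c₁ c₂ X₁ X₂ _ = record { coh-i = coh-i ; coh-ii = coh-ii }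
    where
    coh-i : ∀ w κ₁ κ₂ → IsPrefix (w ++ [ κ₁ ]) c₁ → IsPrefix (w ++ [ κ₂ ]) c₂ →
            κ₁ ≡ κ₂ ⊎ (Negative κ₁ × Negative κ₂)
    coh-i w κ₁ κ₂ i₁ i₂ with prefix-∷ʳ w κ₁ i₁ | prefix-∷ʳ w κ₂ i₂
    ... | t₁ , e₁ | t₂ , e₂ with Design-same-pol s∈ X₁ X₂ w κ₁ κ₂ t₁ t₂ e₁ e₂ | pol κ₁ ≟ᴾ pos
    ...   | same | yes pκ₁ =
      inj₁ (⌜D*⌝-positive-coherent (proj₁ X₁) (proj₁ X₂) w κ₁ κ₂ t₁ t₂ e₁ e₂ pκ₁ (trans (sym same) pκ₁))
    ...   | same | no κ₁≢pos = inj₂ (nκ₁ , trans (sym same) nκ₁)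
      where
      nκ₁ : Negative κ₁
      nκ₁ = pol≢pos⇒neg κ₁ κ₁≢pos

    coh-ii : ∀ w ξ₁ I₁ w₁ κ₁ ξ₂ I₂ w₂ κ₂ →
             IsPrefix (w ++ act neg ξ₁ I₁ ∷ w₁ ++ [ κ₁ ]) c₁ → IsPrefix (w ++ act neg ξ₂ I₂ ∷ w₂ ++ [ κ₂ ]) c₂ →
             ξ₁ ≢ ξ₂ → DistinctFocus κ₁ κ₂
    coh-ii = ⌜D*⌝-negative-coherent (proj₁ X₁) (proj₁ X₂)

  Design-extend : ∀ {s p q y y' r} → D p → (q ∷ʳ y) ++ y' ∷ r ≡ p → Negative y → StartsIn s ⌜ q ∷ʳ y ⌝ →
                  Design s ⌜ (q ∷ʳ y) ∷ʳ y' ⌝ × StrictPrefix ⌜ q ∷ʳ y ⌝ ⌜ (q ∷ʳ y) ∷ʳ y' ⌝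
  Design-extend {s} {p} {q} {y} {y'} {r} Dp e ny start =
    (((q ∷ʳ y) ∷ʳ y' , (∷ʳ-≢-[] _ y' , p , Dp , (r , trans (++-assoc (q ∷ʳ y) [ y' ] r) e)) , refl) ,
     subst (StartsIn s) (sym extended) (StartsIn-++ [ y' ] start)) ,
    [ y' ] , (λ ()) , sym extended
    where
    py' : Positive y'
    py' = pol≢neg⇒pos y' λ ny' →
      Path.alternate (path Dp) q y y' r (trans (sym e) (++-assoc q [ y ] (y' ∷ r))) (trans ny (sym ny'))
    extended : ⌜ (q ∷ʳ y) ∷ʳ y' ⌝ ≡ ⌜ q ∷ʳ y ⌝ ∷ʳ y'
    extended = view-∷ʳ-pos (q ∷ʳ y) y' py'

  Design-maximal-positive : ∀ {s} c → Design s c → (∀ c' → Design s c' → ¬ StrictPrefix c c') →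
                            ∃₂ λ w κ → c ≡ w ++ [ κ ] × Positive κ
  Design-maximal-positive c ((q , (q≢[] , p , Dp , (r , pr)) , refl) , start) maximal with initLast q
  ... | [] = ⊥-elim (q≢[] refl)
  ... | q' ∷ʳ′ y with view-∷ʳ q' y | pol y ≟ᴾ pos
  ...   | q'' , _ , e | yes py   = ⌜ q'' ⌝ , y , e , py
  ...   | _           | no y≢pos = ⊥-elim (not-last r pr)
    where
    ny : Negative y
    ny = pol≢pos⇒neg y y≢pos

    cannot-extend : ∀ {p'} y' r' → D p' → (q' ∷ʳ y) ++ y' ∷ r' ≡ p' → ⊥
    cannot-extend y' r' Dp' e with Design-extend Dp' e ny start
    ... | X , sp = maximal _ X sp

    p-maximal : p ≡ q' ∷ʳ y → ∀ p' → D p' → ¬ StrictPrefix p p'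
    p-maximal _  p' Dp' ([] , r≢[] , _)      = r≢[] refl
    p-maximal p≡ p' Dp' (y' ∷ r' , _ , e') = cannot-extend y' r' Dp' (trans (cong (_++ y' ∷ r') (sym p≡)) e')

    not-last : ∀ r → (q' ∷ʳ y) ++ r ≡ p → ⊥
    not-last (y' ∷ r') e = cannot-extend y' r' Dp e
    not-last []        e with maxp p Dp (p-maximal (trans (sym e) (++-identityʳ _)))
    ... | w' , κ' , ep , pκ' with ∷ʳ-injective q' w' (trans (sym (++-identityʳ _)) (trans e ep))
    ...   | _ , refl = neg≢pos (trans (sym ny) pκ')

  Design-emptyΓ : ∀ {s} → s ∈ β → Γ s ≡ nothing →
                  (∃ λ c → Design s c) × (∃ λ κ → Positive κ × ∀ c → Design s c → ∃ λ v → c ≡ κ ∷ v)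
  Design-emptyΓ {s} s∈ Γ≡ with Path.emptyΓ (path D₀) s s∈ Γ≡
  ... | κ₀ , v₀ , e₀ , first₀ with empty-Γ-opening Γ≡ first₀
  ...   | pκ₀ , o₀ = ([ κ₀ ] , singleton) , κ₀ , pκ₀ , all-start
    where
    singleton : Design s [ κ₀ ]
    singleton = ([ κ₀ ] , ((λ ()) , p₀ , D₀ , (v₀ , sym e₀)) , view-∷ʳ-pos [] κ₀ pκ₀) , κ₀ , [] , refl , o₀

    D-starts : ∀ p → D p → ∃ λ v → p ≡ κ₀ ∷ v
    D-starts p Dp with p ≟ᴸ p₀ | Path.emptyΓ (path Dp) s s∈ Γ≡
    ... | yes refl | _ = v₀ , e₀
    ... | no p≢p₀  | κ , v , e , first =
      v , trans e (cong (_∷ v) (proj₂ (CoherentPaths.first (coh p p₀ Dp D₀ p≢p₀) κ v κ₀ v₀ e e₀)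
                                       (proj₁ (empty-Γ-opening Γ≡ first))))

    all-start : ∀ c → Design s c → ∃ λ v → c ≡ κ₀ ∷ v
    all-start []      ((q , (q≢[] , _) , e) , _) = ⊥-elim (q≢[] (view-≡-[] q e))
    all-start (κ ∷ v) X@((q , (_ , p , Dp , (r , pr)) , e) , _) with Design-first s∈ X
    ... | inj₂ (_ , _ , Γ≡') with () ← trans (sym Γ≡) Γ≡'
    ... | inj₁ (pκ , _) with PathPrefix.view-first-positive (path Dp) q r pr κ v e pκ | D-starts p Dp
    ...   | _ , ep | _ , ep₀ with ∷-injective (trans (sym ep) ep₀)
    ...     | refl , _ = v , refl

  Design-isDesign : ∀ {s} → s ∈ β → IsDesign s (Design s)
  Design-isDesign {s} s∈ = record
    { baseOK       = locs-disjoint disj s∈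
    ; chronicles   = Design-chronicle s∈
    ; prefixClosed = λ c c' (V , start) c'≢[] c'⊑c →
                       ⌜D*⌝-prefix-closed c c' V c'≢[] c'⊑c , StartsIn-prefix start c'≢[] c'⊑c
    ; coherent     = Design-coherent s∈
    ; maximalPos   = Design-maximal-positive
    ; emptyΓ       = Design-emptyΓ s∈
    }

  ⌜D*⌝-covered : ∀ c → ViewSet β D* c → Any (λ s → Design s c) β
  ⌜D*⌝-covered c V@(q , (q≢[] , p , Dp , (r , pr)) , refl) with PathPrefix.view-startsIn-some (path Dp) q r pr q≢[]
  ... | s , s∈ , start = lose s∈ (V , start)

proposition3p6 : (β : List Seq) → IsBaseOfNet β →
    (D : List Action → Set) →
    (∃ λ p → D p) →
    (∀ p → D p → p ≢ [] × Path β p) →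
    (∀ p q → D p → D q → p ≢ q → CoherentPaths β p q) →
    (∀ p → D p → (∀ q → D q → ¬ StrictPrefix p q) → PositivePath p) →
    NetOfDesigns β (ViewSet β (PrefixClosure D))
proposition3p6 β bn D D≢∅ paths coh maxp = record
  { designs       = map (λ s → s , Design s) β
  ; based         = All.map⁺ (tabulate λ s∈ → s∈ , Design-isDesign s∈)
  ; disjointBases = AllPairs.map⁺ (sequents-disjoint (IsBaseOfNet.disjointLoci bn))
  ; union→        = λ c V → map⁺ (⌜D*⌝-covered c V)
  ; union←        = λ c a → proj₁ (proj₂ (satisfied (map⁻ a)))
  }
  where open Construction β bn D D≢∅ paths coh maxp
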